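{- Let $(\delta,K_1,K_2,C_0,C_1)$ be admissible, let $M$ be a magic distance, and let $\mathbf C$ be a non-metric cycle (edge labels $a,x_1,\dots,x_k$ with $a>\sum_{i=1}^k x_i$). If $\mathbf C$ has at least 4 vertices, then $\mathbf C$ has a tension.
   Context: A $\delta$-edge-labelled cycle is a cycle graph (at least 3 vertices) with edge labels in $\{1,\dots,\delta\}$; two edges are neighbouring if they share a vertex. Parameters: integers with $3\le\delta<\infty$, $1\le K_1\le K_2\le\delta$, $2\delta+2\le C_0,C_1\le3\delta+2$, $C_0$ even, $C_1$ odd; $C=\min(C_0,C_1)$, $C'=\max(C_0,C_1)$. Admissible means either Case II: $C\le2\delta+K_1$, $C=2K_1+2K_2+1$, $K_1+K_2\ge\delta$, $K_1+2K_2\le2\delta-1$, and either $C'=C+1$ or ($C'>C+1$, $K_1=K_2$, $3K_2=2\delta-1$); or Case III: $C>2\delta+K_1$, $K_1+2K_2\ge2\delta-1$, $3K_2\ge2\delta$, if $K_1+2K_2=2\delta-1$ then $C\ge2\delta+K_1+2$, if $C'>C+1$ then $C\ge2\delta+K_2$. Magic distance: $M\in\{1,\dots,\delta\}$ with $\max(K_1,\lceil\delta/2\rceil)\le M\le\min(K_2,\lfloor(C-\delta-1)/2\rfloor)$, such that moreover $M>K_1$ if Case III holds with $K_1+2K_2=2\delta-1$, and $M<K_2$ if Case III holds with $C'>C+1$ and $C=2\delta+K_2$. Operation: $x\oplus y=|x-y|$ if $|x-y|>M$; otherwise $\min(x+y,C-1-x-y)$ if this is $<M$; otherwise $M$. A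 cycle has a tension if it has neighbouring edges with labels $a,b$ such that $a\oplus b\ne M$. -}

module Defs where

open import Data.Nat.Base
open import Data.Bool.Base using (if_then_else_)
open import Data.Fin.Base using (Fin; zero; suc; toℕ; fromℕ<)
open import Data.Nat.DivMod using (_%_)
open import Data.Product using (_×_; ∃-syntax; Σ-syntax)
open import Data.Sum using (_⊎_)
open import Relation.Binary.PropositionalEquality using (_≡_; _≢_)
open import Relation.Nullary using (yes; no)
open import Data.Nat.Properties using (_<?_)

record Params : Set where
  constructor params
  field
    δ K₁ K₂ C₀ C₁ : ℕ

  C : ℕ
  C = C₀ ⊓ C₁

  C′ : ℕ
  C′ = C₀ ⊔ C₁

open Params public

StandingAssumptions : Params → Set
StandingAssumptions p =
  3 ≤ δ p × 1 ≤ K₁ p × K₁ p ≤ K₂ p × K₂ p ≤ δ p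
  × 2 * δ p + 2 ≤ C₀ p × C₀ p ≤ 3 * δ p + 2
  × 2 * δ p + 2 ≤ C₁ p × C₁ p ≤ 3 * δ p + 2
  × (∃[ k ] C₀ p ≡ 2 * k) × (∃[ k ] C₁ p ≡ 1 + 2 * k)

CaseII : Params → Set
CaseII p =
  C p ≤ 2 * δ p + K₁ p
  × C p ≡ 2 * K₁ p + 2 * K₂ p + 1
  × δ p ≤ K₁ p + K₂ p
  × K₁ p + 2 * K₂ p ≤ 2 * δ p ∸ 1
  × (C′ p ≡ C p + 1
     ⊎ (C p + 1 < C′ p × K₁ p ≡ K₂ p × 3 * K₂ p ≡ 2 * δ p ∸ 1))

CaseIII : Params → Set
CaseIII p =
  2 * δ p + K₁ p < C p
  × 2 * δ p ∸ 1 ≤ K₁ p + 2 * K₂ p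
  × 2 * δ p ≤ 3 * K₂ p
  × (K₁ p + 2 * K₂ p ≡ 2 * δ p ∸ 1 → 2 * δ p + K₁ p + 2 ≤ C p)
  × (C p + 1 < C′ p → 2 * δ p + K₂ p ≤ C p)

Admissible : Params → Set
Admissible p = StandingAssumptions p × (CaseII p ⊎ CaseIII p)

MagicDistance : Params → ℕ → Set
MagicDistance p M =
  1 ≤ M × M ≤ δ p
  × K₁ p ≤ M × ⌈ δ p /2⌉ ≤ M
  × M ≤ K₂ p × M ≤ ⌊ (C p ∸ δ p ∸ 1) /2⌋
  × (CaseIII p → K₁ p + 2 * K₂ p ≡ 2 * δ p ∸ 1 → K₁ p < M)
  × (CaseIII p → C p + 1 < C′ p → C p ≡ 2 * δ p + K₂ p → M < K₂ p)

-- The operation x ⊕ y (with respect to M and C).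
-- (Natural subtraction in C-1-x-y is harmless: for labels ≤ δ, x+y ≤ 2δ < C-1.)
⊕op : ℕ → ℕ → ℕ → ℕ → ℕ
⊕op M Cc x y =
  if M <ᵇ ∣ x - y ∣ then ∣ x - y ∣
  else (if ((x + y) ⊓ (Cc ∸ 1 ∸ x ∸ y)) <ᵇ M
        then (x + y) ⊓ (Cc ∸ 1 ∸ x ∸ y)
        else M)

-- A δ-edge-labelled cycle with n vertices (n ≥ 3): edges indexed by Fin n
-- in cyclic order, edge i and edge i+1 (mod n) share a vertex.
record LabelledCycle (δ : ℕ) : Set where
  field
    n      : ℕ
    n≥3    : 3 ≤ n
    label  : Fin n → ℕ
    label≥1 : ∀ i → 1 ≤ label i
    label≤δ : ∀ i → label i ≤ δ

open LabelledCycle public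

nextFin : ∀ {n} → Fin n → Fin n
nextFin {suc m} i with suc (toℕ i) <? suc m
... | yes p = fromℕ< p
... | no _  = zero

sumFin : ∀ {n} → (Fin n → ℕ) → ℕ
sumFin {zero}  f = 0
sumFin {suc n} f = f zero + sumFin (λ i → f (suc i))

NonMetric : ∀ {δ} → LabelledCycle δ → Set
NonMetric c = ∃[ i ] (sumFin (label c) ∸ label c i < label c i)

HasTension : ∀ {δ} → ℕ → ℕ → LabelledCycle δ → Set
HasTension M Cc c = ∃[ i ] (⊕op M Cc (label c i) (label c (nextFin i)) ≢ M)

-- If a cycle has no tension, then x ⊕ y = M forces ∣x − y∣ ≤ M ≤ x + y for every pair of
-- neighbouring labels.  Starting at the long edge a, with x₁, x₂, x₃ the next three labels,
-- this gives a ≤ x₁ + M ≤ x₁ + x₂ + x₃; with at least four vertices these edges are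
-- distinct, so a is at most the sum of the other labels and the cycle is metric.
module Submission where

open import Defs
open import Algebra.Properties.CommutativeSemigroup using (x∙yz≈y∙xz)
open import Data.Bool.Base using (true; false)
open import Data.Fin.Base using (Fin; toℕ) renaming (zero to fzero; suc to fsuc)
open import Data.Fin.Properties using (toℕ-fromℕ<; toℕ<n; ¬∀⟶∃¬)
open import Data.List.Base using (List; []; _∷_; map)
open import Data.List.Relation.Unary.All using (All; []; _∷_)
open import Data.List.Relation.Unary.AllPairs using ([]; _∷_)
open import Data.List.Relation.Unary.Unique.Propositional using (Unique)
open import Data.Nat.Base
open import Data.Nat.DivMod using (_%_; %-distribˡ-+; m%n%n≡m%n; m%n<n; m<n⇒m%n≡m; n%n≡0; [m+n]%n≡m%n)
open import Data.Nat.GeneralisedArithmetic using (iterate)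
open import Data.Nat.ListAction using (sum)
open import Data.Nat.Properties
open import Data.Product using (_,_)
open import Relation.Nullary using (yes; no; contradiction)
open import Relation.Nullary.Reflects using (ofʸ; ofⁿ)
open import Relation.Binary.PropositionalEquality

⊕op≡M⇒∣x-y∣≤M : ∀ M Cc x y → ⊕op M Cc x y ≡ M → ∣ x - y ∣ ≤ M
⊕op≡M⇒∣x-y∣≤M M Cc x y eq with M <ᵇ ∣ x - y ∣ | <ᵇ-reflects-< M ∣ x - y ∣
... | true  | ofʸ M<∣x-y∣ = contradiction (sym eq) (<⇒≢ M<∣x-y∣)
... | false | ofⁿ M≮∣x-y∣ = ≮⇒≥ M≮∣x-y∣

⊕op≡M⇒M≤x+y : ∀ M Cc x y → ⊕op M Cc x y ≡ M → M ≤ x + y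
⊕op≡M⇒M≤x+y M Cc x y eq with M <ᵇ ∣ x - y ∣ | <ᵇ-reflects-< M ∣ x - y ∣
... | true  | ofʸ M<∣x-y∣ = contradiction (sym eq) (<⇒≢ M<∣x-y∣)
... | false | _ with (x + y) ⊓ (Cc ∸ 1 ∸ x ∸ y) <ᵇ M | <ᵇ-reflects-< ((x + y) ⊓ (Cc ∸ 1 ∸ x ∸ y)) M
...   | true  | ofʸ small<M = contradiction eq (<⇒≢ small<M)
...   | false | ofⁿ small≮M = ≤-trans (≮⇒≥ small≮M) (m⊓n≤m (x + y) _)

⊕op≡M⇒x≤y+M : ∀ M Cc x y → ⊕op M Cc x y ≡ M → x ≤ y + M
⊕op≡M⇒x≤y+M M Cc x y eq =
  ≤-trans (m≤n+m∸n x y) (+-monoʳ-≤ y (≤-trans (m∸n≤∣m-n∣ x y) (⊕op≡M⇒∣x-y∣≤M M Cc x y eq)))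

erase : ∀ {n} → Fin n → (Fin n → ℕ) → Fin n → ℕ
erase fzero    f fzero    = 0
erase fzero    f (fsuc k) = f (fsuc k)
erase (fsuc i) f fzero    = f fzero
erase (fsuc i) f (fsuc k) = erase i (λ j → f (fsuc j)) k

erase-≢ : ∀ {n} {i k : Fin n} (f : Fin n → ℕ) → i ≢ k → erase i f k ≡ f k
erase-≢ {i = fzero}  {fzero}  f i≢k = contradiction refl i≢k
erase-≢ {i = fzero}  {fsuc k} f i≢k = refl
erase-≢ {i = fsuc i} {fzero}  f i≢k = refl
erase-≢ {i = fsuc i} {fsuc k} f i≢k = erase-≢ (λ j → f (fsuc j)) (λ i≡k → i≢k (cong fsuc i≡k))

sumFin-erase : ∀ {n} (i : Fin n) (f : Fin n → ℕ) → sumFin f ≡ f i + sumFin (erase i f)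
sumFin-erase fzero    f = refl
sumFin-erase (fsuc i) f = begin
  f fzero + sumFin f′                          ≡⟨ cong (f fzero +_) (sumFin-erase i f′) ⟩
  f fzero + (f (fsuc i) + sumFin (erase i f′)) ≡⟨ x∙yz≈y∙xz +-commutativeSemigroup (f fzero) (f (fsuc i)) _ ⟩
  f (fsuc i) + (f fzero + sumFin (erase i f′)) ∎
  where
  open ≡-Reasoning
  f′ = λ j → f (fsuc j)

map-erase : ∀ {n} {i : Fin n} (f : Fin n → ℕ) {ks : List (Fin n)} →
            All (i ≢_) ks → map (erase i f) ks ≡ map f ks
map-erase f []           = refl
map-erase f (i≢k ∷ i≢ks) = cong₂ _∷_ (erase-≢ f i≢k) (map-erase f i≢ks)

sum-≤-sumFin : ∀ {n} (f : Fin n → ℕ) {ks : List (Fin n)} → Unique ks → sum (map f ks) ≤ sumFin f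
sum-≤-sumFin f {[]}     []              = z≤n
sum-≤-sumFin f {k ∷ ks} (k≢ks ∷ unique) = begin
  f k + sum (map f ks)            ≡⟨ cong (λ xs → f k + sum xs) (map-erase f k≢ks) ⟨
  f k + sum (map (erase k f) ks)  ≤⟨ +-monoʳ-≤ (f k) (sum-≤-sumFin (erase k f) unique) ⟩
  f k + sumFin (erase k f)        ≡⟨ sumFin-erase k f ⟨
  sumFin f                        ∎
  where open ≤-Reasoning

[m%n+k]%n≡[m+k]%n : ∀ m k n .{{_ : NonZero n}} → (m % n + k) % n ≡ (m + k) % n
[m%n+k]%n≡[m+k]%n m k n = begin
  (m % n + k) % n         ≡⟨ %-distribˡ-+ (m % n) k n ⟩
  (m % n % n + k % n) % n ≡⟨ cong (λ x → (x + k % n) % n) (m%n%n≡m%n m n) ⟩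
  (m % n + k % n) % n     ≡⟨ %-distribˡ-+ m k n ⟨
  (m + k) % n             ∎
  where open ≡-Reasoning

[m+k]%n≢m : ∀ {m k n} .{{_ : NonZero n}} → m < n → 0 < k → k < n → (m + k) % n ≢ m
[m+k]%n≢m {m} {k} {n} m<n 0<k k<n eq with m + k <? n
... | yes m+k<n = <⇒≢ 0<k (sym (+-cancelˡ-≡ m k 0 (begin
  m + k       ≡⟨ m<n⇒m%n≡m m+k<n ⟨
  (m + k) % n ≡⟨ eq ⟩
  m           ≡⟨ +-identityʳ m ⟨
  m + 0       ∎)))
  where open ≡-Reasoning
... | no  m+k≮n = <⇒≢ k<n (sym (+-cancelˡ-≡ m n k (begin
  m + n               ≡⟨ cong (_+ n) wrapped≡m ⟨
  (m + k ∸ n) + n     ≡⟨ m∸n+n≡m n≤m+k ⟩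
  m + k               ∎)))
  where
  open ≡-Reasoning
  n≤m+k : n ≤ m + k
  n≤m+k = ≮⇒≥ m+k≮n
  wrapped≡m : m + k ∸ n ≡ m
  wrapped≡m = begin
    m + k ∸ n             ≡⟨ m<n⇒m%n≡m (m<n+o⇒m∸n<o (m + k) n (+-mono-< m<n k<n)) ⟨
    (m + k ∸ n) % n       ≡⟨ [m+n]%n≡m%n (m + k ∸ n) n ⟨
    ((m + k ∸ n) + n) % n ≡⟨ cong (_% n) (m∸n+n≡m n≤m+k) ⟩
    (m + k) % n           ≡⟨ eq ⟩
    m                     ∎

toℕ-nextFin : ∀ {n} (k : Fin (suc n)) → toℕ (nextFin k) ≡ suc (toℕ k) % suc n
toℕ-nextFin {n} k with suc (toℕ k) <? suc n
... | yes k+1<n = trans (toℕ-fromℕ< k+1<n) (sym (m<n⇒m%n≡m k+1<n))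
... | no  k+1≮n = trans (sym (n%n≡0 (suc n)))
                        (cong (_% suc n) (≤-antisym (≮⇒≥ k+1≮n) (toℕ<n k)))

toℕ-iterate-nextFin : ∀ {n} (k : Fin (suc n)) d →
                      toℕ (iterate nextFin k d) ≡ (toℕ k + d) % suc n
toℕ-iterate-nextFin {n} k zero =
  sym (trans (cong (_% suc n) (+-identityʳ (toℕ k))) (m<n⇒m%n≡m (toℕ<n k)))
toℕ-iterate-nextFin {n} k (suc d) = begin
  toℕ (iterate nextFin (nextFin k) d) ≡⟨ toℕ-iterate-nextFin (nextFin k) d ⟩
  (toℕ (nextFin k) + d) % suc n       ≡⟨ cong (λ x → (x + d) % suc n) (toℕ-nextFin k) ⟩
  (suc (toℕ k) % suc n + d) % suc n   ≡⟨ [m%n+k]%n≡[m+k]%n (suc (toℕ k)) d (suc n) ⟩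
  (suc (toℕ k) + d) % suc n           ≡⟨ cong (_% suc n) (+-suc (toℕ k) d) ⟨
  (toℕ k + suc d) % suc n             ∎
  where open ≡-Reasoning

iterate-nextFin-≢ : ∀ {n} (k : Fin (suc n)) {a b} → a < b → b < suc n →
                    iterate nextFin k a ≢ iterate nextFin k b
iterate-nextFin-≢ {n} k {a} {b} a<b b<n eq =
  [m+k]%n≢m (m%n<n (toℕ k + a) (suc n)) (m<n⇒0<n∸m a<b) (≤-<-trans (m∸n≤m b a) b<n) (begin
    ((toℕ k + a) % suc n + (b ∸ a)) % suc n ≡⟨ [m%n+k]%n≡[m+k]%n (toℕ k + a) (b ∸ a) (suc n) ⟩
    (toℕ k + a + (b ∸ a)) % suc n           ≡⟨ cong (_% suc n) (+-assoc (toℕ k) a (b ∸ a)) ⟩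
    (toℕ k + (a + (b ∸ a))) % suc n         ≡⟨ cong (λ x → (toℕ k + x) % suc n) (m+[n∸m]≡n (<⇒≤ a<b)) ⟩
    (toℕ k + b) % suc n                     ≡⟨ toℕ-iterate-nextFin k b ⟨
    toℕ (iterate nextFin k b)               ≡⟨ cong toℕ eq ⟨
    toℕ (iterate nextFin k a)               ≡⟨ toℕ-iterate-nextFin k a ⟩
    (toℕ k + a) % suc n                     ∎)
  where open ≡-Reasoning

tensionFree⇒label≤others : ∀ {n} M Cc (f : Fin n → ℕ) → 4 ≤ n →
                           (∀ k → ⊕op M Cc (f k) (f (nextFin k)) ≡ M) →
                           ∀ i → f i ≤ sumFin f ∸ f i
tensionFree⇒label≤others M Cc f 4≤n@(s≤s _) tensionFree i = begin
  f i                            ≤⟨ ⊕op≡M⇒x≤y+M M Cc (f i) (f (x 1)) (tensionFree i) ⟩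
  f (x 1) + M                    ≤⟨ +-monoʳ-≤ (f (x 1)) (⊕op≡M⇒M≤x+y M Cc (f (x 2)) (f (x 3)) (tensionFree (x 2))) ⟩
  f (x 1) + (f (x 2) + f (x 3))  ≡⟨ cong (λ y → f (x 1) + (f (x 2) + y)) (+-identityʳ (f (x 3))) ⟨
  sum (map f next3)              ≡⟨ m+n∸m≡n (f i) _ ⟨
  sum (map f (i ∷ next3)) ∸ f i  ≤⟨ ∸-monoˡ-≤ (f i) (sum-≤-sumFin f distinct) ⟩
  sumFin f ∸ f i                 ∎
  where
  open ≤-Reasoning
  x = iterate nextFin i
  next3 = x 1 ∷ x 2 ∷ x 3 ∷ []
  x-≢ : ∀ {a b} → a < b → b ≤ 3 → x a ≢ x b
  x-≢ a<b b≤3 = iterate-nextFin-≢ i a<b (≤-<-trans b≤3 4≤n)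
  distinct : Unique (i ∷ next3)
  distinct = (x-≢ {0} {1} z<s (s≤s z≤n) ∷ x-≢ {0} {2} z<s (s≤s (s≤s z≤n)) ∷ x-≢ {0} {3} z<s ≤-refl ∷ [])
           ∷ (x-≢ {1} {2} (s<s z<s) (s≤s (s≤s z≤n)) ∷ x-≢ {1} {3} (s<s z<s) ≤-refl ∷ [])
           ∷ (x-≢ {2} {3} (s<s (s<s z<s)) ≤-refl ∷ [])
           ∷ [] ∷ []

mainTheorem10 : (p : Params) → Admissible p → (M : ℕ) → MagicDistance p M →
                (c : LabelledCycle (δ p)) → NonMetric c → 4 ≤ n c →
                HasTension M (C p) c
mainTheorem10 p _ M _ c (i , others<label) 4≤n =
  ¬∀⟶∃¬ (n c) (λ k → ⊕op M (C p) (label c k) (label c (nextFin k)) ≡ M)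
        (λ k → ⊕op M (C p) (label c k) (label c (nextFin k)) ≟ M)
        (λ tensionFree → <⇒≱ others<label
           (tensionFree⇒label≤others M (C p) (label c) 4≤n tensionFree i))
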